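{- Let $a,\rho,t,\omega$ be rational numbers satisfying $$a^2\rho^3 t^4 + (3a\rho^2 - 1)t^2 + a\rho^3 = \omega^2 .$$ Define $p = t(a\rho t^2 + 1)$, $q = \omega$, $r = \omega t$, $s = t^2 + \rho$. Then $pq(p^2+q^2) = a\,rs(r^2+s^2)$; equivalently, $A=p+q$, $B=r-s$, $C=p-q$, $D=r+s$ satisfy $A^4 + aB^4 = C^4 + aD^4$. -}

module Defs where

open import Data.Rational using (ℚ; _+_; _*_; _-_; 1ℚ)

sq : ℚ → ℚ
sq x = x * x

cube : ℚ → ℚ
cube x = x * x * x

pow4 : ℚ → ℚ
pow4 x = sq x * sq x

three : ℚ
three = 1ℚ + 1ℚ + 1ℚ

module Submission where

-- Write  C(a,ρ,t) = a²ρ³t⁴ + (3aρ² − 1)t² + aρ³  for the quartic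
-- in t appearing in the hypothesis.  With  p = t(aρt² + 1), q = ω, r = ωt,
-- s = t² + ρ  a direct expansion gives the polynomial identity
--   pq(p² + q²) − a·rs(r² + s²) = ωt(1 − at⁴)·(ω² − C(a,ρ,t)),
-- so the first claim holds as soon as  C(a,ρ,t) = ω².  The second claim is
-- a consequence of the first for arbitrary p, q, r, s, because
--   (p+q)⁴ + a(r−s)⁴ − (p−q)⁴ − a(r+s)⁴ = 8·(pq(p² + q²) − a·rs(r² + s²)).

open import Defs
open import Data.Rational using (ℚ; _+_; _*_; _-_; 0ℚ; 1ℚ)
open import Data.Rational.Properties using (+-inverseʳ; *-zeroʳ; +-identityʳ)
open import Data.Rational.Solver using (module +-*-Solver)
open import Data.Product using (_×_; _,_)
open import Relation.Binary.PropositionalEquality using (_≡_; refl; cong; sym; module ≡-Reasoning)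
open ≡-Reasoning

open +-*-Solver using (solve; _:=_; _:+_; _:-_; _:*_; con)

equalUpToVanishingTerm : ∀ {x y u v : ℚ} (k : ℚ) →
  x ≡ y + k * (u - v) → u ≡ v → x ≡ y
equalUpToVanishingTerm {x} {y} {u} {v} k x≡y+k[u-v] refl = begin
  x               ≡⟨ x≡y+k[u-v] ⟩
  y + k * (u - u) ≡⟨ cong (λ d → y + k * d) (+-inverseʳ u) ⟩
  y + k * 0ℚ      ≡⟨ cong (y +_) (*-zeroʳ k) ⟩
  y + 0ℚ          ≡⟨ +-identityʳ y ⟩
  y               ∎

curve : ℚ → ℚ → ℚ → ℚ
curve a ρ t = sq a * cube ρ * pow4 t + (three * a * sq ρ - 1ℚ) * sq t + a * cube ρ

parametrisationDefect : ∀ (a ρ t ω : ℚ) →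
  let p = t * (a * ρ * sq t + 1ℚ)
      q = ω
      r = ω * t
      s = sq t + ρ
  in p * q * (sq p + sq q)
     ≡ a * (r * s * (sq r + sq s)) + ω * t * (1ℚ - a * pow4 t) * (sq ω - curve a ρ t)
parametrisationDefect = solve 4 (λ a ρ t ω →
  let sq′ x = x :* x
      cube′ x = x :* x :* x
      pow4′ x = sq′ x :* sq′ x
      one = con 1ℚ
      p = t :* (a :* ρ :* sq′ t :+ one)
      r = ω :* t
      s = sq′ t :+ ρ
      curve′ = sq′ a :* cube′ ρ :* pow4′ t
               :+ (con three :* a :* sq′ ρ :- one) :* sq′ t :+ a :* cube′ ρ
  in p :* ω :* (sq′ p :+ sq′ ω)
     := a :* (r :* s :* (sq′ r :+ sq′ s)) :+ ω :* t :* (one :- a :* pow4′ t) :* (sq′ ω :- curve′))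
  refl

eight : ℚ
eight = 1ℚ + 1ℚ + 1ℚ + 1ℚ + 1ℚ + 1ℚ + 1ℚ + 1ℚ

quarticDefect : ∀ (a p q r s : ℚ) →
  pow4 (p + q) + a * pow4 (r - s)
  ≡ pow4 (p - q) + a * pow4 (r + s)
    + eight * (p * q * (sq p + sq q) - a * (r * s * (sq r + sq s)))
quarticDefect = solve 5 (λ a p q r s →
  let sq′ x = x :* x
      pow4′ x = sq′ x :* sq′ x
  in pow4′ (p :+ q) :+ a :* pow4′ (r :- s)
     := pow4′ (p :- q) :+ a :* pow4′ (r :+ s)
        :+ con eight :* (p :* q :* (sq′ p :+ sq′ q) :- a :* (r :* s :* (sq′ r :+ sq′ s))))
  refl

quarticFromQuadratic : ∀ (a p q r s : ℚ) →
  p * q * (sq p + sq q) ≡ a * (r * s * (sq r + sq s)) →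
  pow4 (p + q) + a * pow4 (r - s) ≡ pow4 (p - q) + a * pow4 (r + s)
quarticFromQuadratic a p q r s =
  equalUpToVanishingTerm eight (quarticDefect a p q r s)

mainTheorem1 : (a ρ t ω : ℚ) →
    sq a * cube ρ * pow4 t + (three * a * sq ρ - 1ℚ) * sq t + a * cube ρ ≡ sq ω →
    let p = t * (a * ρ * sq t + 1ℚ)
        q = ω
        r = ω * t
        s = sq t + ρ
    in (p * q * (sq p + sq q) ≡ a * (r * s * (sq r + sq s)))
       × (pow4 (p + q) + a * pow4 (r - s) ≡ pow4 (p - q) + a * pow4 (r + s))
mainTheorem1 a ρ t ω onCurve = quadratic , quarticFromQuadratic a p ω r s quadratic
  where
  p r s : ℚ
  p = t * (a * ρ * sq t + 1ℚ)
  r = ω * t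
  s = sq t + ρ

  quadratic : p * ω * (sq p + sq ω) ≡ a * (r * s * (sq r + sq s))
  quadratic = equalUpToVanishingTerm (ω * t * (1ℚ - a * pow4 t))
    (parametrisationDefect a ρ t ω) (sym onCurve)
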